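{- Let $\mathbb{K}$ be a finite field and $x\in\mathbb{K}$ with $x\neq 0_{\mathbb{K}}$. Then the $(x,\mathbb{K})$-monomial minimal solution of $(E_{\mathbb{K}})$ is irreducible.
   Context: Let $A$ be a commutative unital ring ($0_A\neq 1_A$). For $a_1,\ldots,a_n\in A$ set $M_n(a_1,\ldots,a_n)=\begin{pmatrix} a_n & -1_A\\ 1_A & 0_A\end{pmatrix}\cdots\begin{pmatrix} a_1 & -1_A\\ 1_A & 0_A\end{pmatrix}$. An $n$-tuple is a solution of $(E_A)$ if $M_n(a_1,\ldots,a_n)=\pm \mathrm{Id}$. For tuples, $(a_1,\ldots,a_n)\oplus(b_1,\ldots,b_m)=(a_1+b_m,a_2,\ldots,a_{n-1},a_n+b_1,b_2,\ldots,b_{m-1})$. Write $(a_1,\ldots,a_n)\sim(b_1,\ldots,b_n)$ if $(b_1,\ldots,b_n)$ is obtained from $(a_1,\ldots,a_n)$ or from $(a_n,\ldots,a_1)$ by a cyclic permutation. A solution $(c_1,\ldots,c_n)$ with $n\geq 3$ is reducible if there exist a solution $(b_1,\ldots,b_l)$ and a tuple $(a_1,\ldots,a_m)$ of elements of $A$ with $l,m\geq 3$ and $(c_1,\ldots,c_n)\sim(a_1,\ldots,a_m)\oplus(b_1,\ldots,b_l)$; otherwise it is irreducible. For $A$ finite and $x\in A$, the $(x,A)$-monomial minimal solution of $(E_A)$ is the solution all of whose components equal $x$, of minimal size; it exists. -}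

module Defs where

open import Level using (Level; _⊔_)
open import Algebra.Bundles using (CommutativeRing)
open import Data.Nat using (ℕ; _≤_)
open import Data.Fin using (Fin)
open import Data.List using (List; []; _∷_; _++_; [_]; length; drop; take; reverse; replicate)
open import Data.List.Relation.Binary.Pointwise using (Pointwise)
open import Data.Product using (Σ; ∃; _×_; _,_)
open import Data.Sum using (_⊎_)
open import Relation.Nullary using (¬_)

IsField : ∀ {c ℓ} → CommutativeRing c ℓ → Set (c ⊔ ℓ)
IsField R = ¬ (1# ≈ 0#) × (∀ x → ¬ (x ≈ 0#) → ∃ λ y → x * y ≈ 1#)
  where open CommutativeRing R

IsFinite : ∀ {c ℓ} → CommutativeRing c ℓ → Set (c ⊔ ℓ)
IsFinite R = ∃ λ (k : ℕ) → Σ (Fin k → Carrier) λ f → ∀ y → ∃ λ i → f i ≈ y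
  where open CommutativeRing R

module Frieze {c ℓ} (A : CommutativeRing c ℓ) where
  open CommutativeRing A

  record Mat2 : Set c where
    constructor mat
    field p q r s : Carrier

  _≈M_ : Mat2 → Mat2 → Set ℓ
  mat a b c' d ≈M mat a' b' c'' d' = (a ≈ a') × (b ≈ b') × (c' ≈ c'') × (d ≈ d')

  _·_ : Mat2 → Mat2 → Mat2
  mat a b c' d · mat a' b' c'' d' =
    mat (a * a' + b * c'') (a * b' + b * d') (c' * a' + d * c'') (c' * b' + d * d')

  Id : Mat2
  Id = mat 1# 0# 0# 1#

  -Id : Mat2
  -Id = mat (- 1#) 0# 0# (- 1#)

  T : Carrier → Mat2
  T a = mat a (- 1#) 1# 0#

  -- M (a₁ ∷ … ∷ aₙ) = T aₙ · … · T a₁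
  M : List Carrier → Mat2
  M [] = Id
  M (a ∷ as) = M as · T a

  IsSolution : List Carrier → Set ℓ
  IsSolution cs = (M cs ≈M Id) ⊎ (M cs ≈M -Id)

  -- (a₁ ∷ am ++ [aₙ]) ⊕ (b₁ ∷ bm ++ [bₘ])
  --   = (a₁ + bₘ) ∷ am ++ (aₙ + b₁) ∷ bm
  tuple : Carrier → List Carrier → Carrier → List Carrier
  tuple a₁ am aₙ = a₁ ∷ am ++ [ aₙ ]

  ⊕-parts : Carrier → List Carrier → Carrier → Carrier → List Carrier → Carrier → List Carrier
  ⊕-parts a₁ am aₙ b₁ bm bₘ = (a₁ + bₘ) ∷ am ++ (aₙ + b₁) ∷ bm

  _≋_ : List Carrier → List Carrier → Set (c ⊔ ℓ)
  _≋_ = Pointwise _≈_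

  rotate : ℕ → List Carrier → List Carrier
  rotate k xs = drop k xs ++ take k xs

  _∼_ : List Carrier → List Carrier → Set (c ⊔ ℓ)
  cs ∼ ds = ∃ λ k → k ≤ length cs × (ds ≋ rotate k cs ⊎ ds ≋ rotate k (reverse cs))

  -- reducible: cs ∼ (a₁,…,a_m) ⊕ (b₁,…,b_l) with (b₁,…,b_l) a solution and l, m ≥ 3
  -- (m = length am + 2 ≥ 3, l = length bm + 2 ≥ 3)
  Reducible : List Carrier → Set (c ⊔ ℓ)
  Reducible cs = Σ Carrier λ a₁ → Σ (List Carrier) λ am → Σ Carrier λ aₙ →
                 Σ Carrier λ b₁ → Σ (List Carrier) λ bm → Σ Carrier λ bₘ →
                 (1 ≤ length am) × (1 ≤ length bm) ×
                 IsSolution (tuple b₁ bm bₘ) ×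
                 (cs ∼ ⊕-parts a₁ am aₙ b₁ bm bₘ)

  Irreducible : List Carrier → Set (c ⊔ ℓ)
  Irreducible cs = IsSolution cs × 3 ≤ length cs × ¬ Reducible cs

  IsMonomialMinimal : Carrier → ℕ → Set ℓ
  IsMonomialMinimal x n = 1 ≤ n × IsSolution (replicate n x) ×
                          (∀ m → 1 ≤ m → m Data.Nat.< n → ¬ IsSolution (replicate m x))

{-# OPTIONS --safe #-}
module Submission where

-- Suppose (x,…,x) of minimal length n were (a₁,…,a_m) ⊕ (b₁,…,b_l) with (b₁,…,b_l) a solution.
-- All inner entries of b equal x, so b = (b, x,…,x, b′) with k = l − 2 copies of x and k + 2 < n.
-- With P = M (x,…,x) (k factors), T b′ · P · T b = ±Id and P commutes with T x. Comparing entries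
-- gives b = b′, q b′ = q x for the upper right entry q of P, and P = ∓Id when q = 0. Minimality
-- rules out P = ±Id, so q ≠ 0 and, in a field, b = b′ = x: then (x,…,x) of length k + 2 < n is a
-- solution, contradicting minimality again.

open import Defs
open import Algebra.Bundles using (CommutativeRing)
open import Data.Nat using (ℕ)
open import Data.List using (replicate)
open import Relation.Nullary using (¬_)

open import Algebra.Definitions using (AlmostLeftCancellative)
open import Data.Nat using (zero; suc; z≤n; s≤s; _≤_; _<_)
import Data.Nat as ℕ
import Data.Nat.Properties as ℕₚ
open import Data.List using (List; []; _∷_; _++_; [_]; length; drop; take; reverse)
import Data.List.Properties as List
open import Data.List.Relation.Unary.All as All using (All; []; _∷_)
open import Data.List.Relation.Unary.All.Properties using (++⁺; ++⁻ʳ; drop⁺; take⁺; replicate⁺)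
open import Data.List.Relation.Binary.Pointwise as Pointwise using ([]; _∷_; Pointwise-length; All-resp-Pointwise)
open import Data.Product using (Σ; _×_; _,_)
open import Data.Sum using (_⊎_; inj₁; inj₂)
open import Data.Empty using (⊥-elim)
open import Relation.Binary.Bundles using (Setoid)
open import Relation.Binary.Structures using (IsEquivalence)
open import Relation.Binary.Definitions using (_Respects_)
open import Relation.Binary.PropositionalEquality as ≡ using (_≡_)

All-reverse⁺ : ∀ {a p} {A : Set a} {P : A → Set p} {xs : List A} → All P xs → All P (reverse xs)
All-reverse⁺ [] = []
All-reverse⁺ {P = P} {x ∷ xs} (px ∷ pxs) =
  ≡.subst (All P) (≡.sym (List.unfold-reverse x xs)) (++⁺ (All-reverse⁺ pxs) (px ∷ []))

module _ {c ℓ} (K : CommutativeRing c ℓ) where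
  open CommutativeRing K
  open Frieze K
  open import Algebra.Properties.Ring ring
    using (-‿involutive; -‿injective; -‿distribˡ-*; -‿distribʳ-*; -1*x≈-x; -0#≈0#;
           +-inverseʳ-unique; +-cancelʳ; x∙y⁻¹≈ε⇒x≈y)
  open import Algebra.Properties.CommutativeSemigroup +-commutativeSemigroup using (interchange)
  import Relation.Binary.Reasoning.Setoid as SetoidReasoning
  module ≈-Reasoning = SetoidReasoning setoid

  1*x+0*y≈x : ∀ x y → 1# * x + 0# * y ≈ x
  1*x+0*y≈x x y = trans (+-cong (*-identityˡ x) (zeroˡ y)) (+-identityʳ x)

  0*x+1*y≈y : ∀ x y → 0# * x + 1# * y ≈ y
  0*x+1*y≈y x y = trans (+-cong (zeroˡ x) (*-identityˡ y)) (+-identityˡ y)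

  x*1+y*0≈x : ∀ x y → x * 1# + y * 0# ≈ x
  x*1+y*0≈x x y = trans (+-cong (*-identityʳ x) (zeroʳ y)) (+-identityʳ x)

  x*0+y*1≈y : ∀ x y → x * 0# + y * 1# ≈ y
  x*0+y*1≈y x y = trans (+-cong (zeroʳ x) (*-identityʳ y)) (+-identityˡ y)

  x*-1+y*0≈-x : ∀ x y → x * - 1# + y * 0# ≈ - x
  x*-1+y*0≈-x x y = trans (+-cong (trans (*-comm x (- 1#)) (-1*x≈-x x)) (zeroʳ y)) (+-identityʳ (- x))

  -x*-y≈x*y : ∀ x y → - x * - y ≈ x * y
  -x*-y≈x*y x y = begin
    - x * - y     ≈⟨ -‿distribˡ-* x (- y) ⟨
    - (x * - y)   ≈⟨ -‿cong (-‿distribʳ-* x y) ⟨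
    - - (x * y)   ≈⟨ -‿involutive (x * y) ⟩
    x * y         ∎
    where open ≈-Reasoning

  -x≈y⇒x≈-y : ∀ {x y} → - x ≈ y → x ≈ - y
  -x≈y⇒x≈-y {x} -x≈y = trans (sym (-‿involutive x)) (-‿cong -x≈y)

  *-cancelˡ-invertible : ∀ {u w v v′} → u * w ≈ 1# → u * v ≈ u * v′ → v ≈ v′
  *-cancelˡ-invertible {u} {w} {v} {v′} uw≈1 uv≈uv′ = begin
    v               ≈⟨ w*[u*x]≈x v ⟨
    w * (u * v)     ≈⟨ *-congˡ uv≈uv′ ⟩
    w * (u * v′)    ≈⟨ w*[u*x]≈x v′ ⟩
    v′              ∎
    where
    open ≈-Reasoning
    w*[u*x]≈x : ∀ x → w * (u * x) ≈ x
    w*[u*x]≈x x = begin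
      w * (u * x)   ≈⟨ *-assoc w u x ⟨
      (w * u) * x   ≈⟨ *-congʳ (trans (*-comm w u) uw≈1) ⟩
      1# * x        ≈⟨ *-identityˡ x ⟩
      x             ∎

  IsField⇒*-almostCancelˡ : IsField K → AlmostLeftCancellative _≈_ 0# _*_
  IsField⇒*-almostCancelˡ (_ , inverse) u v v′ u≉0 with inverse u u≉0
  ... | w , uw≈1 = *-cancelˡ-invertible uw≈1

  ≈M-isEquivalence : IsEquivalence _≈M_
  ≈M-isEquivalence = record
    { refl  = refl , refl , refl , refl
    ; sym   = λ (p , q , r , s) → sym p , sym q , sym r , sym s
    ; trans = λ (p , q , r , s) (p′ , q′ , r′ , s′) → trans p p′ , trans q q′ , trans r r′ , trans s s′
    }

  ≈M-setoid : Setoid c ℓ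
  ≈M-setoid = record { isEquivalence = ≈M-isEquivalence }

  open IsEquivalence ≈M-isEquivalence using () renaming (refl to ≈M-refl; sym to ≈M-sym; trans to ≈M-trans)
  module ≈M-Reasoning = SetoidReasoning ≈M-setoid

  ·-cong : ∀ {N₁ N₁′ N₂ N₂′} → N₁ ≈M N₁′ → N₂ ≈M N₂′ → (N₁ · N₂) ≈M (N₁′ · N₂′)
  ·-cong (p , q , r , s) (p′ , q′ , r′ , s′) =
    +-cong (*-cong p p′) (*-cong q r′) , +-cong (*-cong p q′) (*-cong q s′) ,
    +-cong (*-cong r p′) (*-cong s r′) , +-cong (*-cong r q′) (*-cong s s′)

  ·-assoc : ∀ N₁ N₂ N₃ → ((N₁ · N₂) · N₃) ≈M (N₁ · (N₂ · N₃))
  ·-assoc (mat p q r s) (mat p′ q′ r′ s′) (mat p″ q″ r″ s″) =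
    row-assoc p q p″ r″ , row-assoc p q q″ s″ , row-assoc r s p″ r″ , row-assoc r s q″ s″
    where
    row-assoc : ∀ u v w z →
      (u * p′ + v * r′) * w + (u * q′ + v * s′) * z ≈ u * (p′ * w + q′ * z) + v * (r′ * w + s′ * z)
    row-assoc u v w z = begin
      (u * p′ + v * r′) * w + (u * q′ + v * s′) * z
        ≈⟨ +-cong (distribʳ w (u * p′) (v * r′)) (distribʳ z (u * q′) (v * s′)) ⟩
      (u * p′ * w + v * r′ * w) + (u * q′ * z + v * s′ * z)
        ≈⟨ interchange _ _ _ _ ⟩
      (u * p′ * w + u * q′ * z) + (v * r′ * w + v * s′ * z)
        ≈⟨ +-cong (+-cong (*-assoc u p′ w) (*-assoc u q′ z)) (+-cong (*-assoc v r′ w) (*-assoc v s′ z)) ⟩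
      (u * (p′ * w) + u * (q′ * z)) + (v * (r′ * w) + v * (s′ * z))
        ≈⟨ +-cong (distribˡ u (p′ * w) (q′ * z)) (distribˡ v (r′ * w) (s′ * z)) ⟨
      u * (p′ * w + q′ * z) + v * (r′ * w + s′ * z)
        ∎
      where open ≈-Reasoning

  ·-identityˡ : ∀ N → (Id · N) ≈M N
  ·-identityˡ (mat p q r s) = 1*x+0*y≈x p r , 1*x+0*y≈x q s , 0*x+1*y≈y p r , 0*x+1*y≈y q s

  ·-identityʳ : ∀ N → (N · Id) ≈M N
  ·-identityʳ (mat p q r s) = x*1+y*0≈x p q , x*0+y*1≈y p q , x*1+y*0≈x r s , x*0+y*1≈y r s

  T-cong : ∀ {a b} → a ≈ b → T a ≈M T b
  T-cong a≈b = a≈b , refl , refl , refl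

  T·mat : ∀ a p q r s → (T a · mat p q r s) ≈M mat (a * p - r) (a * q - s) p q
  T·mat a p q r s = +-congˡ (-1*x≈-x r) , +-congˡ (-1*x≈-x s) , 1*x+0*y≈x p r , 1*x+0*y≈x q s

  mat·T : ∀ p q r s a → (mat p q r s · T a) ≈M mat (p * a + q) (- p) (r * a + s) (- r)
  mat·T p q r s a = +-congˡ (*-identityʳ q) , x*-1+y*0≈-x p q , +-congˡ (*-identityʳ s) , x*-1+y*0≈-x r s

  scalar : Carrier → Mat2
  scalar e = mat e 0# 0# e

  Is±Id : Mat2 → Set ℓ
  Is±Id N = (N ≈M Id) ⊎ (N ≈M -Id)

  Is±Id-resp : ∀ {N N′} → N ≈M N′ → Is±Id N → Is±Id N′
  Is±Id-resp N≈N′ (inj₁ N≈Id)  = inj₁ (≈M-trans (≈M-sym N≈N′) N≈Id)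
  Is±Id-resp N≈N′ (inj₂ N≈-Id) = inj₂ (≈M-trans (≈M-sym N≈N′) N≈-Id)

  Is±Id⇒r≈0 : ∀ {N} → Is±Id N → Mat2.r N ≈ 0#
  Is±Id⇒r≈0 (inj₁ (_ , _ , r≈0 , _)) = r≈0
  Is±Id⇒r≈0 (inj₂ (_ , _ , r≈0 , _)) = r≈0

  M-cong : ∀ {xs ys} → xs ≋ ys → M xs ≈M M ys
  M-cong []            = ≈M-refl
  M-cong (x≈y ∷ xs≋ys) = ·-cong (M-cong xs≋ys) (T-cong x≈y)

  M-++ : ∀ xs ys → M (xs ++ ys) ≈M (M ys · M xs)
  M-++ []       ys = ≈M-sym (·-identityʳ (M ys))
  M-++ (x ∷ xs) ys = ≈M-trans (·-cong (M-++ xs ys) ≈M-refl) (·-assoc (M ys) (M xs) (T x))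

  M-tuple : ∀ b bm b′ → M (tuple b bm b′) ≈M ((T b′ · M bm) · T b)
  M-tuple b bm b′ = ·-cong (≈M-trans (M-++ bm [ b′ ]) (·-cong (·-identityˡ (T b′)) ≈M-refl)) ≈M-refl

  T-comm-M-replicate : ∀ x k → (T x · M (replicate k x)) ≈M (M (replicate k x) · T x)
  T-comm-M-replicate x zero    = ≈M-trans (·-identityʳ (T x)) (≈M-sym (·-identityˡ (T x)))
  T-comm-M-replicate x (suc k) = begin
    T x · (P · T x)   ≈⟨ ·-assoc (T x) P (T x) ⟨
    (T x · P) · T x   ≈⟨ ·-cong (T-comm-M-replicate x k) ≈M-refl ⟩
    (P · T x) · T x   ∎
    where
    open ≈M-Reasoning
    P = M (replicate k x)

  Is±Id⇒scalar : ∀ {N} → Is±Id N →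
    Σ Carrier λ e → (e * e ≈ 1#) × (N ≈M scalar e) × Is±Id (scalar (- e))
  Is±Id⇒scalar (inj₁ N≈Id)  = 1# , *-identityʳ 1# , N≈Id , inj₂ ≈M-refl
  Is±Id⇒scalar (inj₂ N≈-Id) =
    - 1# , trans (-x*-y≈x*y 1# 1#) (*-identityʳ 1#) , N≈-Id ,
    inj₁ (-‿involutive 1# , refl , refl , -‿involutive 1#)

  sandwich-entries : ∀ {a b e p q r s} → ((T a · mat p q r s) · T b) ≈M scalar e →
    (- p ≈ e) × (p * b + q ≈ 0#) × (r ≈ a * p) × (a * q - s ≈ e)
  sandwich-entries {a} {b} {e} {p} {q} {r} {s} H
    with ≈M-trans (≈M-sym (≈M-trans (·-cong (T·mat a p q r s) ≈M-refl) (mat·T _ _ _ _ b))) H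
  ... | [ap-r]b+[aq-s]≈e , -[ap-r]≈0 , pb+q≈0 , -p≈e =
    -p≈e , pb+q≈0 , sym (x∙y⁻¹≈ε⇒x≈y (a * p) r ap-r≈0) , aq-s≈e
    where
    open ≈-Reasoning
    ap-r≈0 : a * p - r ≈ 0#
    ap-r≈0 = trans (-x≈y⇒x≈-y -[ap-r]≈0) -0#≈0#
    aq-s≈e : a * q - s ≈ e
    aq-s≈e = begin
      a * q - s                        ≈⟨ +-identityˡ (a * q - s) ⟨
      0# + (a * q - s)                 ≈⟨ +-congʳ (trans (*-congʳ ap-r≈0) (zeroˡ b)) ⟨
      (a * p - r) * b + (a * q - s)    ≈⟨ [ap-r]b+[aq-s]≈e ⟩
      e                                ∎

  commuting-entries : ∀ {x p q r s} → (T x · mat p q r s) ≈M (mat p q r s · T x) →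
    (x * q - s ≈ - p) × (q ≈ - r)
  commuting-entries {x} {p} {q} {r} {s} C
    with ≈M-trans (≈M-sym (T·mat x p q r s)) (≈M-trans C (mat·T p q r s x))
  ... | _ , xq-s≈-p , _ , q≈-r = xq-s≈-p , q≈-r

  sandwich-commuting : ∀ {a b x e p q r s} → e * e ≈ 1# →
    ((T a · mat p q r s) · T b) ≈M scalar e → (T x · mat p q r s) ≈M (mat p q r s · T x) →
    (b ≈ a) × (q * a ≈ q * x) × (q ≈ 0# → mat p q r s ≈M scalar (- e))
  sandwich-commuting {a} {b} {x} {e} {p} {q} {r} {s} e²≈1 H C
    with sandwich-entries H | commuting-entries C
  ... | -p≈e , pb+q≈0 , r≈ap , aq-s≈e | xq-s≈-p , q≈-r = b≈a , qa≈qx , q≈0⇒scalar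
    where
    open ≈-Reasoning
    p≈-e = -x≈y⇒x≈-y -p≈e
    p²≈1 : p * p ≈ 1#
    p²≈1 = trans (*-cong p≈-e p≈-e) (trans (-x*-y≈x*y e e) e²≈1)
    b≈a : b ≈ a
    b≈a = *-cancelˡ-invertible p²≈1 (-‿injective (begin
      - (p * b)   ≈⟨ +-inverseʳ-unique (p * b) q pb+q≈0 ⟨
      q           ≈⟨ q≈-r ⟩
      - r         ≈⟨ -‿cong (trans r≈ap (*-comm a p)) ⟩
      - (p * a)   ∎))
    aq≈xq : a * q ≈ x * q
    aq≈xq = +-cancelʳ (- s) (a * q) (x * q) (begin
      a * q - s   ≈⟨ aq-s≈e ⟩
      e           ≈⟨ -p≈e ⟨
      - p         ≈⟨ xq-s≈-p ⟨
      x * q - s   ∎)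
    qa≈qx = trans (*-comm q a) (trans aq≈xq (*-comm x q))
    q≈0⇒scalar : q ≈ 0# → mat p q r s ≈M scalar (- e)
    q≈0⇒scalar q≈0 = p≈-e , q≈0 , r≈0 , -x≈y⇒x≈-y -s≈e
      where
      r≈0 = trans (-x≈y⇒x≈-y (trans (sym q≈-r) q≈0)) -0#≈0#
      -s≈e = begin
        - s           ≈⟨ +-identityˡ (- s) ⟨
        0# + - s      ≈⟨ +-congʳ (trans (*-congˡ q≈0) (zeroʳ a)) ⟨
        a * q - s     ≈⟨ aq-s≈e ⟩
        e             ∎

  ±Id-sandwich⇒flanks≈ : IsField K → ∀ {a b x} P → (T x · P) ≈M (P · T x) → ¬ Is±Id P →
    Is±Id ((T a · P) · T b) → (a ≈ x) × (b ≈ x)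
  ±Id-sandwich⇒flanks≈ isField (mat p q r s) C ¬±P ±H with Is±Id⇒scalar ±H
  ... | e , e²≈1 , H , ±[-e] with sandwich-commuting e²≈1 H C
  ... | b≈a , qa≈qx , q≈0⇒scalar = a≈x , trans b≈a a≈x
    where
    q≉0 : ¬ q ≈ 0#
    q≉0 q≈0 = ¬±P (Is±Id-resp (≈M-sym (q≈0⇒scalar q≈0)) ±[-e])
    a≈x = IsField⇒*-almostCancelˡ isField q _ _ q≉0 qa≈qx

  rotate-length : ∀ k xs → length (rotate k xs) ≡ length xs
  rotate-length k xs = begin
    length (drop k xs ++ take k xs)           ≡⟨ List.length-++ (drop k xs) ⟩
    length (drop k xs) ℕ.+ length (take k xs) ≡⟨ ≡.cong₂ ℕ._+_ (List.length-drop k xs) (List.length-take k xs) ⟩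
    (length xs ℕ.∸ k) ℕ.+ (k ℕ.⊓ length xs)   ≡⟨ ℕₚ.+-comm (length xs ℕ.∸ k) _ ⟩
    (k ℕ.⊓ length xs) ℕ.+ (length xs ℕ.∸ k)   ≡⟨ ℕₚ.m⊓n+n∸m≡n k (length xs) ⟩
    length xs                                 ∎
    where open ≡.≡-Reasoning

  ∼-length : ∀ {cs ds} → cs ∼ ds → length ds ≡ length cs
  ∼-length {cs} (k , _ , inj₁ ds≋) = ≡.trans (Pointwise-length ds≋) (rotate-length k cs)
  ∼-length {cs} (k , _ , inj₂ ds≋) =
    ≡.trans (Pointwise-length ds≋) (≡.trans (rotate-length k (reverse cs)) (List.length-reverse cs))

  rotate-All : ∀ {p} {P : Carrier → Set p} k {xs} → All P xs → All P (rotate k xs)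
  rotate-All k Pxs = ++⁺ (drop⁺ k Pxs) (take⁺ k Pxs)

  ∼-All : ∀ {p} {P : Carrier → Set p} → P Respects _≈_ → ∀ {cs ds} → All P cs → cs ∼ ds → All P ds
  ∼-All resp Pcs (k , _ , inj₁ ds≋) =
    All-resp-Pointwise resp (Pointwise.symmetric sym ds≋) (rotate-All k Pcs)
  ∼-All resp Pcs (k , _ , inj₂ ds≋) =
    All-resp-Pointwise resp (Pointwise.symmetric sym ds≋) (rotate-All k (All-reverse⁺ Pcs))

  All≈⇒≋replicate : ∀ {x xs} → All (_≈ x) xs → xs ≋ replicate (length xs) x
  All≈⇒≋replicate []            = []
  All≈⇒≋replicate (y≈x ∷ ys≈x) = y≈x ∷ All≈⇒≋replicate ys≈x

  ¬IsSolution[a] : ¬ 1# ≈ 0# → ∀ a → ¬ IsSolution [ a ]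
  ¬IsSolution[a] 1≉0 a sol = 1≉0 (trans (sym (0*x+1*y≈y a 1#)) (Is±Id⇒r≈0 sol))

  IsSolution[a,b]⇒a≈0 : ∀ {a b} → IsSolution (a ∷ b ∷ []) → a ≈ 0#
  IsSolution[a,b]⇒a≈0 {a} {b} sol = trans (sym M[a,b]-r≈a) (Is±Id⇒r≈0 sol)
    where
    M[a,b]-r≈a : Mat2.r (M (a ∷ b ∷ [])) ≈ a
    M[a,b]-r≈a = trans (+-cong (*-congʳ (0*x+1*y≈y b 1#)) (*-congʳ (0*x+1*y≈y (- 1#) 0#))) (1*x+0*y≈x a 1#)

  monomial-length≥3 : ¬ 1# ≈ 0# → ∀ {x} → ¬ x ≈ 0# → ∀ n → 1 ≤ n → IsSolution (replicate n x) → 3 ≤ n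
  monomial-length≥3 1≉0 x≉0 1                   _ sol = ⊥-elim (¬IsSolution[a] 1≉0 _ sol)
  monomial-length≥3 1≉0 x≉0 2                   _ sol = ⊥-elim (x≉0 (IsSolution[a,b]⇒a≈0 sol))
  monomial-length≥3 1≉0 x≉0 (suc (suc (suc n))) _ _   = s≤s (s≤s (s≤s z≤n))

  flanked-solution⇒monomial-solution : IsField K → ∀ {x k b b′} → ¬ IsSolution (replicate k x) →
    IsSolution (tuple b (replicate k x) b′) → IsSolution (replicate (2 ℕ.+ k) x)
  flanked-solution⇒monomial-solution isField {x} {k} {b} {b′} ¬sol sol =
    flanks≈x⇒solution (±Id-sandwich⇒flanks≈ isField P (T-comm-M-replicate x k) ¬sol ±sandwich)
    where
    P = M (replicate k x)
    ±sandwich : Is±Id ((T b′ · P) · T b)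
    ±sandwich = Is±Id-resp (M-tuple b (replicate k x) b′) sol
    flanks≈x⇒solution : (b′ ≈ x) × (b ≈ x) → IsSolution (replicate (2 ℕ.+ k) x)
    flanks≈x⇒solution (b′≈x , b≈x) = Is±Id-resp (begin
      (T b′ · P) · T b   ≈⟨ ·-cong (·-cong (T-cong b′≈x) ≈M-refl) (T-cong b≈x) ⟩
      (T x · P) · T x    ≈⟨ ·-cong (T-comm-M-replicate x k) ≈M-refl ⟩
      (P · T x) · T x    ∎) ±sandwich
      where open ≈M-Reasoning

  monomial-minimal⇒¬Reducible : IsField K → ∀ {x n} → IsMonomialMinimal x n → ¬ Reducible (replicate n x)
  monomial-minimal⇒¬Reducible isField {x} {n} (_ , _ , minimal)
    (a₁ , am , aₙ , b₁ , bm , bₘ , 1≤|am| , 1≤|bm| , solB , rel) =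
    minimal (2 ℕ.+ k) (s≤s z≤n) 2+k<n
      (flanked-solution⇒monomial-solution isField {x} {k} {b₁} {bₘ}
        (minimal k 1≤|bm| k<n) (Is±Id-resp (M-cong tuple≋) solB))
    where
    k = length bm
    parts≈x : All (_≈ x) (⊕-parts a₁ am aₙ b₁ bm bₘ)
    parts≈x = ∼-All (λ y≈z y≈x → trans (sym y≈z) y≈x) (replicate⁺ n refl) rel
    tuple≋ : tuple b₁ bm bₘ ≋ tuple b₁ (replicate k x) bₘ
    tuple≋ = refl ∷ Pointwise.++⁺ (All≈⇒≋replicate (All.tail (++⁻ʳ am (All.tail parts≈x)))) (refl ∷ [])
    2+k<n : 2 ℕ.+ k < n
    2+k<n = ≡.subst (2 ℕ.+ k <_) (≡.trans (∼-length rel) (List.length-replicate n))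
      (s≤s (ℕₚ.≤-trans (ℕₚ.+-monoˡ-≤ (suc k) 1≤|am|) (ℕₚ.≤-reflexive (≡.sym (List.length-++ am)))))
    k<n : k < n
    k<n = ℕₚ.<-trans (ℕₚ.m<n+m k {2} (s≤s z≤n)) 2+k<n

theorem4p3 : ∀ {c ℓ} (K : CommutativeRing c ℓ) → IsField K → IsFinite K →
    (x : CommutativeRing.Carrier K) → ¬ (CommutativeRing._≈_ K x (CommutativeRing.0# K)) →
    (n : ℕ) → Frieze.IsMonomialMinimal K x n → Frieze.Irreducible K (replicate n x)
-- Finiteness is only needed for the minimal solution to exist, and that is assumed here.
theorem4p3 K isField@(1≉0 , _) _ x x≉0 n minimal@(1≤n , sol , _) =
  sol ,
  ≡.subst (3 ≤_) (≡.sym (List.length-replicate n)) (monomial-length≥3 K 1≉0 x≉0 n 1≤n sol) ,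
  monomial-minimal⇒¬Reducible K isField minimal
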